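{- Let $f:\{0,1\}^n\to\{0,1\}$ be a monotone Boolean function. Then there is a $1$-goal function $g$ for $f$ that gives no value to $0$'s, whose $1$-goal value is $\Gamma^1(f)$. Similarly, there is a $0$-goal function $g$ for $f$ that gives no value to $1$'s, whose $0$-goal value is $\Gamma^0(f)$.
   Context: A partial assignment is $b\in\{0,1,*\}^n$; $a\succeq b$ means $a_i=b_i$ whenever $b_i\ne *$. $b$ is a $0$-certificate (resp. $1$-certificate) of $f$ if $f(a)=0$ (resp. $1$) for all $a\in\{0,1\}^n$ with $a\succeq b$. For $b_i=*$, $b_{x_i\leftarrow\ell}$ is $b$ with coordinate $i$ set to $\ell\in\{0,1\}$. $g:\{0,1,*\}^n\to\mathbb{Z}_{\ge0}$ is monotone if $g(b_{x_i\leftarrow\ell})\ge g(b)$ whenever $b_i=*$, and submodular if $g(b_{x_i\leftarrow\ell})-g(b)\ge g(b'_{x_i\leftarrow\ell})-g(b')$ whenever $b'\succeq b$, $b_i=b'_i=*$. A $1$-goal function for $f$ is a monotone submodular $g$ with a constant $Q\ge0$ (its $1$-goal value) such that $g(b)=Q$ if $b$ is a $1$-certificate of $f$ and $g(b)<Q$ otherwise; $\Gamma^1(f)$ is the minimum $1$-goal value of a $1$-goal function for $f$. $0$-goal functions, $0$-goal value and $\Gamma^0(f)$ are defined analogously with $0$-certificates. A function $g$ gives no value to $0$'s if $g(b)=g(b')$ for every partial assignment $b$, where $b'$ is obtained from $b$ by changing every $0$ to $*$; "gives no value to $1$'s" is defined analogously. -}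

module Defs where

open import Data.Nat using (ℕ; _≤_; _<_; _+_)
open import Data.Bool using (Bool; true; false)
open import Data.Fin using (Fin; _≟_)
open import Data.Product using (_×_; Σ; ∃; _,_)
open import Data.Empty using (⊥)
open import Relation.Binary.PropositionalEquality using (_≡_; _≢_)
open import Relation.Nullary using (yes; no)

-- Boolean inputs {0,1}^n, with 0 = false, 1 = true.
Assignment : ℕ → Set
Assignment n = Fin n → Bool

data _≤ᵇ_ : Bool → Bool → Set where
  f≤b : ∀ {b} → false ≤ᵇ b
  t≤t : true ≤ᵇ true

Monotone : ∀ {n} → (Assignment n → Bool) → Set
Monotone {n} f = ∀ (a b : Assignment n) → (∀ i → a i ≤ᵇ b i) → f a ≤ᵇ f b

data Tri : Set where
  zero* one* star : Tri

PAssign : ℕ → Set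
PAssign n = Fin n → Tri

bit : Bool → Tri
bit false = zero*
bit true  = one*

_⪰_ : ∀ {n} → Assignment n → PAssign n → Set
a ⪰ b = ∀ i → b i ≢ star → bit (a i) ≡ b i

_⪰ₚ_ : ∀ {n} → PAssign n → PAssign n → Set
b' ⪰ₚ b = ∀ i → b i ≢ star → b' i ≡ b i

IsCert : ∀ {n} → (Assignment n → Bool) → Bool → PAssign n → Set
IsCert f ℓ b = ∀ a → a ⪰ b → f a ≡ ℓ

set : ∀ {n} → PAssign n → Fin n → Bool → PAssign n
set b i ℓ j with j ≟ i
... | yes _ = bit ℓ
... | no  _ = b j

MonotoneG : ∀ {n} → (PAssign n → ℕ) → Set
MonotoneG {n} g = ∀ (b : PAssign n) i ℓ → b i ≡ star → g b ≤ g (set b i ℓ)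

-- submodularity, stated additively (all values are natural numbers):
-- g(b_{i←ℓ}) - g(b) ≥ g(b'_{i←ℓ}) - g(b')  ⟺  g(b'_{i←ℓ}) + g(b) ≤ g(b_{i←ℓ}) + g(b')
Submodular : ∀ {n} → (PAssign n → ℕ) → Set
Submodular {n} g = ∀ (b b' : PAssign n) i ℓ → b' ⪰ₚ b → b i ≡ star → b' i ≡ star →
  g (set b' i ℓ) + g b ≤ g (set b i ℓ) + g b'

IsGoal : ∀ {n} → (Assignment n → Bool) → Bool → (PAssign n → ℕ) → ℕ → Set
IsGoal f ℓ g Q = MonotoneG g × Submodular g ×
  (∀ b → (IsCert f ℓ b → g b ≡ Q) × ((IsCert f ℓ b → ⊥) → g b < Q))

IsGamma : ∀ {n} → (Assignment n → Bool) → Bool → ℕ → Set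
IsGamma {n} f ℓ Q = (Σ (PAssign n → ℕ) λ g → IsGoal f ℓ g Q) ×
  (∀ (g : PAssign n → ℕ) Q' → IsGoal f ℓ g Q' → Q ≤ Q')

eraseSym : Bool → Tri → Tri
eraseSym false zero* = star
eraseSym true  one*  = star
eraseSym _     t     = t

erase : ∀ {n} → Bool → PAssign n → PAssign n
erase ℓ b i = eraseSym ℓ (b i)

NoValueTo : ∀ {n} → Bool → (PAssign n → ℕ) → Set
NoValueTo ℓ g = ∀ b → g b ≡ g (erase ℓ b)

-- For monotone f, erasing the ¬ℓ entries of an ℓ-certificate leaves an ℓ-certificate:
-- a total assignment consistent with the erased certificate is reached from one
-- consistent with the certificate by moving coordinates towards ℓ. Hence if g is an
-- ℓ-goal function, so is b ↦ g (b with its ¬ℓ's erased), with the same goal value, and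
-- it gives no value to ¬ℓ's. Applied to a goal function of value Γ^ℓ(f) this proves
-- the theorem.
--
-- Constructively the minimum Γ^ℓ(f) has to be found by search. A goal function that
-- respects pointwise equality is bounded by its goal value, so it is given by a finite
-- table, and being a goal function is decidable for it; counting the inputs ruled out
-- gives a goal function of some value, so a least tabulable value exists. Every goal
-- value is tabulable by the same erasure: on ¬ℓ-free assignments a goal function
-- already respects pointwise equality (and when f (ℓ,…,ℓ) ≠ ℓ there are no
-- ℓ-certificates, so the constant 0 is a goal function).
module Submission where

open import Defs
open import Data.Nat using (ℕ; zero; suc; _+_; _≤_; _<_; z≤n; s≤s; _≤?_; _<?_)
  renaming (_≟_ to _≟ℕ_)
open import Data.Nat.Properties
  using (≤-refl; ≤-reflexive; ≤-trans; ≤-antisym; <⇒≤; ≤-<-trans; +-comm; +-cancelˡ-≤;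
         +-mono-≤; +-mono-<-≤; +-mono-≤-<; +-commutativeSemigroup)
open import Algebra.Properties.CommutativeSemigroup +-commutativeSemigroup using (interchange)
open import Data.Bool using (Bool; true; false; not) renaming (_≟_ to _≟B_)
open import Data.Bool.Properties using (not-¬)
open import Data.Fin using (Fin; toℕ; fromℕ<; _≟_)
open import Data.Fin.Properties using (all?; any?; toℕ-fromℕ<)
open import Data.List using (List; []; _∷_; allFin)
open import Data.List.Membership.Propositional using (_∈_)
open import Data.List.Membership.Propositional.Properties using (∈-allFin)
open import Data.List.Relation.Unary.Any using (here; there)
open import Data.Vec using (Vec; []; _∷_; lookup; tabulate)
open import Data.Vec.Properties using (lookup∘tabulate; tabulate-cong)
open import Data.Product using (Σ; ∃; _×_; _,_; proj₁; proj₂)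
open import Data.Sum using (_⊎_; inj₁; inj₂; [_,_]′)
import Data.Sum as Sum
open import Function using (_∘_; id; const; case_of_)
open import Relation.Binary.Core using (_Preserves_⟶_)
open import Relation.Binary.Definitions using (DecidableEquality)
open import Relation.Binary.PropositionalEquality
open import Relation.Nullary using (Dec; yes; no; ¬_; ¬?; contradiction)
open import Relation.Nullary.Decidable using (_×-dec_; _⊎-dec_; _→-dec_; decidable-stable)

private variable
  n m Q : ℕ
  A B : Set
  ℓ ℓ′ x y : Bool
  t : Tri
  i j : Fin n
  a : Assignment n
  b b′ b″ : PAssign n
  f : Assignment n → Bool
  g g′ : PAssign n → ℕ
  L : List (Fin n)

_≟T_ : DecidableEquality Tri
zero* ≟T zero* = yes refl
zero* ≟T one*  = no λ ()
zero* ≟T star  = no λ ()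
one*  ≟T zero* = no λ ()
one*  ≟T one*  = yes refl
one*  ≟T star  = no λ ()
star  ≟T zero* = no λ ()
star  ≟T one*  = no λ ()
star  ≟T star  = yes refl

bit-injective : bit x ≡ bit y → x ≡ y
bit-injective {false} {false} _ = refl
bit-injective {true}  {true}  _ = refl

bit≢star : bit x ≢ star
bit≢star {false} ()
bit≢star {true}  ()

tri≡bit : t ≢ star → t ≢ bit (not ℓ) → t ≡ bit ℓ
tri≡bit {zero*} {false} _ _ = refl
tri≡bit {zero*} {true}  _ h = contradiction refl h
tri≡bit {one*}  {false} _ h = contradiction refl h
tri≡bit {one*}  {true}  _ _ = refl
tri≡bit {star}          h _ = contradiction refl h

fill : Tri → Bool → Bool
fill zero* _ = false
fill one*  _ = true
fill star  x = x

bit-fill : t ≢ star → bit (fill t x) ≡ t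
bit-fill {zero*} _ = refl
bit-fill {one*}  _ = refl
bit-fill {star}  h = contradiction refl h

complete : PAssign n → Assignment n → Assignment n
complete b a i = fill (b i) (a i)

complete-⪰ : complete b a ⪰ b
complete-⪰ {b = b} i = bit-fill {t = b i}

≤ᵇ-refl : x ≤ᵇ x
≤ᵇ-refl {false} = f≤b
≤ᵇ-refl {true}  = t≤t

≤ᵇ-true : x ≤ᵇ true
≤ᵇ-true {false} = f≤b
≤ᵇ-true {true}  = t≤t

≤ᵇ-antisym : x ≤ᵇ y → y ≤ᵇ x → x ≡ y
≤ᵇ-antisym f≤b f≤b = refl
≤ᵇ-antisym t≤t t≤t = refl

≡⇒≤ᵇ : x ≡ y → x ≤ᵇ y
≡⇒≤ᵇ refl = ≤ᵇ-refl

monotone-cong : Monotone f → f Preserves _≗_ ⟶ _≡_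
monotone-cong {f = f} mf {a} {a′} eq =
  ≤ᵇ-antisym (mf a a′ (≡⇒≤ᵇ ∘ eq)) (mf a′ a (≡⇒≤ᵇ ∘ sym ∘ eq))

_≤[_]_ : Bool → Bool → Bool → Set
x ≤[ true  ] y = x ≤ᵇ y
x ≤[ false ] y = y ≤ᵇ x

≤[]-refl : x ≤[ ℓ ] x
≤[]-refl {ℓ = false} = ≤ᵇ-refl
≤[]-refl {ℓ = true}  = ≤ᵇ-refl

≤[]-top : x ≤[ ℓ ] ℓ
≤[]-top {ℓ = false} = f≤b
≤[]-top {ℓ = true}  = ≤ᵇ-true

monotone-toward : Monotone f → ∀ {a a′} → (∀ i → a i ≤[ ℓ ] a′ i) → f a ≡ ℓ → f a′ ≡ ℓ
monotone-toward {f = f} {ℓ = true}  mf {a} {a′} h fa with f a′ | subst (_≤ᵇ f a′) fa (mf a a′ h)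
... | true | _ = refl
monotone-toward {f = f} {ℓ = false} mf {a} {a′} h fa with f a′ | subst (f a′ ≤ᵇ_) fa (mf a′ a h)
... | false | _ = refl

set-≡ : ∀ (b : PAssign n) i ℓ → set b i ℓ i ≡ bit ℓ
set-≡ _ i _ with i ≟ i
... | yes _ = refl
... | no i≢i = contradiction refl i≢i

set-cong : b ≗ b′ → set b i ℓ ≗ set b′ i ℓ
set-cong {i = i} eq j with j ≟ i
... | yes _ = refl
... | no _ = eq j

≗⇒⪰ₚ : b ≗ b′ → b′ ⪰ₚ b
≗⇒⪰ₚ eq i _ = sym (eq i)

⪰ₚ-trans : b″ ⪰ₚ b′ → b′ ⪰ₚ b → b″ ⪰ₚ b
⪰ₚ-trans ext′ ext i b≢* =
  trans (ext′ i λ b′≡* → b≢* (trans (sym (ext i b≢*)) b′≡*)) (ext i b≢*)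

⪰-⪰ₚ : a ⪰ b′ → b′ ⪰ₚ b → a ⪰ b
⪰-⪰ₚ a⪰ ext i b≢* = trans (a⪰ i λ b′≡* → b≢* (trans (sym (ext i b≢*)) b′≡*)) (ext i b≢*)

≗-⪰ : ∀ {a a′ : Assignment n} → a ≗ a′ → a′ ⪰ b → a ⪰ b
≗-⪰ eq a′⪰ i b≢* = trans (cong bit (eq i)) (a′⪰ i b≢*)

set-⪰ₚ : b i ≡ star → set b i ℓ ⪰ₚ b
set-⪰ₚ {i = i} b≡* j b≢* with j ≟ i
... | yes refl = contradiction b≡* b≢*
... | no _ = refl

⪰-set : b i ≡ star → a ⪰ set b i ℓ → a ⪰ b′ → a ⪰ set b′ i ℓ
⪰-set {b = b} {i = i} {ℓ = ℓ} b≡* a⪰s a⪰b′ j s′≢* with j ≟ i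
... | yes refl = trans (a⪰s j (λ s≡* → bit≢star (trans (sym s≡b) s≡*))) s≡b
  where s≡b = set-≡ b i ℓ
... | no _ = a⪰b′ j s′≢*

IsCert-⪰ₚ : b′ ⪰ₚ b → IsCert f ℓ b → IsCert f ℓ b′
IsCert-⪰ₚ ext cert a a⪰ = cert a (⪰-⪰ₚ a⪰ ext)

IsCert-≗ : b ≗ b′ → IsCert f ℓ b → IsCert f ℓ b′
IsCert-≗ = IsCert-⪰ₚ ∘ ≗⇒⪰ₚ

all-ℓ-if-cert : Monotone f → IsCert f ℓ b → f (λ _ → ℓ) ≡ ℓ
all-ℓ-if-cert {ℓ = ℓ} {b = b} mf cert =
  monotone-toward mf (λ _ → ≤[]-top) (cert (complete b (λ _ → ℓ)) complete-⪰)

-- Finite search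

Searchable : Set → Set₁
Searchable A = ∀ {P : A → Set} → (∀ x → Dec (P x)) → Dec (∃ P)

Exhaustible : Set → Set₁
Exhaustible A = ∀ {P : A → Set} → (∀ x → Dec (P x)) → Dec (∀ x → P x)

searchable⇒exhaustible : Searchable A → Exhaustible A
searchable⇒exhaustible search P? with search (¬? ∘ P?)
... | yes (x , ¬px) = no λ all → ¬px (all x)
... | no ¬∃ = yes λ x → decidable-stable (P? x) λ ¬px → ¬∃ (x , ¬px)

search-Bool : Searchable Bool
search-Bool P? with P? false | P? true
... | yes p | _     = yes (false , p)
... | no _  | yes p = yes (true , p)
... | no ¬p | no ¬q = no λ { (false , p) → ¬p p ; (true , q) → ¬q q }

search-Tri : Searchable Tri
search-Tri P? with P? zero* | P? one* | P? star
... | yes p | _     | _     = yes (zero* , p)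
... | no _  | yes p | _     = yes (one* , p)
... | no _  | no _  | yes p = yes (star , p)
... | no ¬p | no ¬q | no ¬r = no λ { (zero* , p) → ¬p p ; (one* , q) → ¬q q ; (star , r) → ¬r r }

search-× : Searchable A → Searchable B → Searchable (A × B)
search-× searchA searchB P? with searchA (λ x → searchB (λ y → P? (x , y)))
... | yes (x , y , p) = yes ((x , y) , p)
... | no ¬∃ = no λ { ((x , y) , p) → ¬∃ (x , y , p) }

search-Vec : Searchable A → Searchable (Vec A n)
search-Vec {n = zero}  _      P? with P? []
... | yes p = yes ([] , p)
... | no ¬p = no λ { ([] , p) → ¬p p }
search-Vec {n = suc n} search P? with search-× search (search-Vec search) (λ (x , v) → P? (x ∷ v))
... | yes ((x , v) , p) = yes (x ∷ v , p)
... | no ¬∃ = no λ { (x ∷ v , p) → ¬∃ ((x , v) , p) }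

exhaust-Bool : Exhaustible Bool
exhaust-Bool = searchable⇒exhaustible search-Bool

∀-≗-invariant? : Searchable A → {P : (Fin n → A) → Set} → (∀ {u v} → u ≗ v → P u → P v) →
                 (∀ v → Dec (P (lookup v))) → Dec (∀ u → P u)
∀-≗-invariant? search invariant P? with searchable⇒exhaustible (search-Vec search) P?
... | yes all = yes λ u → invariant (lookup∘tabulate u) (all (tabulate u))
... | no ¬all = no λ all → ¬all (all ∘ lookup)

least : {P : ℕ → Set} → (∀ k → Dec (P k)) → ∀ {N} → P N →
        Σ ℕ λ Q → P Q × (∀ {k} → P k → Q ≤ k)
least P? p with P? 0
... | yes p₀ = 0 , p₀ , λ _ → z≤n
least P? {zero}  p | no ¬p₀ = contradiction p ¬p₀
least P? {suc N} p | no ¬p₀ with least (P? ∘ suc) p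
... | Q , pQ , minimal =
  suc Q , pQ , λ { {zero} p₀ → contradiction p₀ ¬p₀ ; {suc k} pk → s≤s (minimal pk) }

⪰? : (a : Assignment n) (b : PAssign n) → Dec (a ⪰ b)
⪰? a b = all? λ i → ¬? (b i ≟T star) →-dec (bit (a i) ≟T b i)

⪰ₚ? : (b′ b : PAssign n) → Dec (b′ ⪰ₚ b)
⪰ₚ? b′ b = all? λ i → ¬? (b i ≟T star) →-dec (b′ i ≟T b i)

IsCert? : f Preserves _≗_ ⟶ _≡_ → ∀ ℓ (b : PAssign n) → Dec (IsCert f ℓ b)
IsCert? {f = f} f-cong ℓ b =
  ∀-≗-invariant? search-Bool (λ eq h v⪰ → trans (sym (f-cong eq)) (h (≗-⪰ eq v⪰)))
    λ a → ⪰? (lookup a) b →-dec (f (lookup a) ≟B ℓ)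

-- A goal function of some value

∑ : (Vec Bool m → ℕ) → ℕ
∑ {zero}  F = F []
∑ {suc m} F = ∑ (F ∘ (false ∷_)) + ∑ (F ∘ (true ∷_))

∑-mono : {F F′ : Vec Bool m → ℕ} → (∀ a → F a ≤ F′ a) → ∑ F ≤ ∑ F′
∑-mono {zero}  h = h []
∑-mono {suc m} h = +-mono-≤ (∑-mono (h ∘ (false ∷_))) (∑-mono (h ∘ (true ∷_)))

∑-cong : {F F′ : Vec Bool m → ℕ} → (∀ a → F a ≡ F′ a) → ∑ F ≡ ∑ F′
∑-cong h = ≤-antisym (∑-mono (≤-reflexive ∘ h)) (∑-mono (≤-reflexive ∘ sym ∘ h))

∑-+ : (F F′ : Vec Bool m → ℕ) → ∑ (λ a → F a + F′ a) ≡ ∑ F + ∑ F′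
∑-+ {zero}  F F′ = refl
∑-+ {suc m} F F′ =
  trans (cong₂ _+_ (∑-+ (F ∘ (false ∷_)) (F′ ∘ (false ∷_))) (∑-+ (F ∘ (true ∷_)) (F′ ∘ (true ∷_))))
        (interchange (∑ (F ∘ (false ∷_))) (∑ (F′ ∘ (false ∷_))) (∑ (F ∘ (true ∷_))) (∑ (F′ ∘ (true ∷_))))

∑-strict : {F F′ : Vec Bool m → ℕ} → (∀ a → F a ≤ F′ a) → ∀ a₀ → F a₀ < F′ a₀ → ∑ F < ∑ F′
∑-strict {zero}  h [] lt = lt
∑-strict {suc m} h (false ∷ a₀) lt =
  +-mono-<-≤ (∑-strict (h ∘ (false ∷_)) a₀ lt) (∑-mono (h ∘ (true ∷_)))
∑-strict {suc m} h (true ∷ a₀) lt =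
  +-mono-≤-< (∑-mono (h ∘ (false ∷_))) (∑-strict (h ∘ (true ∷_)) a₀ lt)

⟦¬_⟧ : Dec A → ℕ
⟦¬ yes _ ⟧ = 0
⟦¬ no _ ⟧ = 1

⟦¬⟧-antitone : (B → A) → (A? : Dec A) (B? : Dec B) → ⟦¬ A? ⟧ ≤ ⟦¬ B? ⟧
⟦¬⟧-antitone _   (yes _) _       = z≤n
⟦¬⟧-antitone _   (no _)  (no _)  = ≤-refl
⟦¬⟧-antitone B⇒A (no ¬a) (yes b) = contradiction (B⇒A b) ¬a

⟦¬⟧-cong : (A → B) → (B → A) → (A? : Dec A) (B? : Dec B) → ⟦¬ A? ⟧ ≡ ⟦¬ B? ⟧
⟦¬⟧-cong A⇒B B⇒A A? B? = ≤-antisym (⟦¬⟧-antitone B⇒A A? B?) (⟦¬⟧-antitone A⇒B B? A?)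

⟦¬⟧-strict : A → ¬ B → (A? : Dec A) (B? : Dec B) → ⟦¬ A? ⟧ < ⟦¬ B? ⟧
⟦¬⟧-strict a _  (no ¬a) _       = contradiction a ¬a
⟦¬⟧-strict _ ¬b _       (yes b) = contradiction b ¬b
⟦¬⟧-strict _ _  (yes _) (no _)  = s≤s z≤n

⟦¬⟧-submodular : ∀ {S Sᵢ S′ S′ᵢ : Set} → (Sᵢ → S) → (S′ → S) → (Sᵢ → S′ → S′ᵢ) →
  (S? : Dec S) (Sᵢ? : Dec Sᵢ) (S′? : Dec S′) (S′ᵢ? : Dec S′ᵢ) →
  ⟦¬ S′ᵢ? ⟧ + ⟦¬ S? ⟧ ≤ ⟦¬ Sᵢ? ⟧ + ⟦¬ S′? ⟧
⟦¬⟧-submodular _ _ _ (yes _) (yes _) (yes _) (yes _) = z≤n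
⟦¬⟧-submodular _ _ Sᵢ⇒S′ᵢ (yes _) (yes sᵢ) (yes s′) (no ¬s′ᵢ) = contradiction (Sᵢ⇒S′ᵢ sᵢ s′) ¬s′ᵢ
⟦¬⟧-submodular _ _ _ (yes _) (yes _) (no _) (yes _) = z≤n
⟦¬⟧-submodular _ _ _ (yes _) (yes _) (no _) (no _)  = ≤-refl
⟦¬⟧-submodular _ _ _ (yes _) (no _)  _      (yes _) = z≤n
⟦¬⟧-submodular _ _ _ (yes _) (no _)  _      (no _)  = s≤s z≤n
⟦¬⟧-submodular Sᵢ⇒S _ _ (no ¬s) (yes sᵢ) _ _ = contradiction (Sᵢ⇒S sᵢ) ¬s
⟦¬⟧-submodular _ S′⇒S _ (no ¬s) (no _) (yes s′) _ = contradiction (S′⇒S s′) ¬s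
⟦¬⟧-submodular _ _ _ (no _) (no _) (no _) (yes _) = s≤s z≤n
⟦¬⟧-submodular _ _ _ (no _) (no _) (no _) (no _)  = ≤-refl

module _ {f : Assignment n → Bool} (f-cong : f Preserves _≗_ ⟶ _≡_) (ℓ : Bool) where

  counterexample : ¬ IsCert f ℓ b → ∃ λ (a : Vec Bool n) → lookup a ⪰ b × f (lookup a) ≢ ℓ
  counterexample {b = b} ¬cert
    with search-Vec search-Bool (λ a → ⪰? (lookup a) b ×-dec ¬? (f (lookup a) ≟B ℓ))
  ... | yes found = found
  ... | no none = contradiction cert ¬cert
    where
    cert : IsCert f ℓ b
    cert a a⪰ = decidable-stable (f a ≟B ℓ) λ fa≢ℓ →
      none (tabulate a , ≗-⪰ (lookup∘tabulate a) a⪰ , fa≢ℓ ∘ trans (sym (f-cong (lookup∘tabulate a))))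

  -- ruledOut b counts the inputs a with f a ≢ ℓ that are inconsistent with b.
  Harmless : Vec Bool n → PAssign n → Set
  Harmless a b = f (lookup a) ≡ ℓ ⊎ lookup a ⪰ b

  harmless? : ∀ a (b : PAssign n) → Dec (Harmless a b)
  harmless? a b = (f (lookup a) ≟B ℓ) ⊎-dec ⪰? (lookup a) b

  ruledOut : PAssign n → ℕ
  ruledOut b = ∑ λ a → ⟦¬ harmless? a b ⟧

  nonℓ : ℕ
  nonℓ = ∑ λ a → ⟦¬ f (lookup a) ≟B ℓ ⟧

  ruledOut-goal : IsGoal f ℓ ruledOut nonℓ
  ruledOut-goal = mono , sub , value
    where
    mono : MonotoneG ruledOut
    mono b i ℓ′ b≡* = ∑-mono λ a →
      ⟦¬⟧-antitone (Sum.map₂ λ a⪰ → ⪰-⪰ₚ a⪰ (set-⪰ₚ b≡*)) (harmless? a b) (harmless? a (set b i ℓ′))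

    sub : Submodular ruledOut
    sub b b′ i ℓ′ ext b≡* b′≡* =
      subst₂ _≤_ (∑-+ (λ a → ⟦¬ harmless? a (set b′ i ℓ′) ⟧) (λ a → ⟦¬ harmless? a b ⟧))
                 (∑-+ (λ a → ⟦¬ harmless? a (set b i ℓ′) ⟧) (λ a → ⟦¬ harmless? a b′ ⟧))
        (∑-mono λ a → ⟦¬⟧-submodular
          (Sum.map₂ λ a⪰ → ⪰-⪰ₚ a⪰ (set-⪰ₚ b≡*))
          (Sum.map₂ λ a⪰ → ⪰-⪰ₚ a⪰ ext)
          (λ { (inj₁ fa≡ℓ) _ → inj₁ fa≡ℓ
             ; (inj₂ _) (inj₁ fa≡ℓ) → inj₁ fa≡ℓ
             ; (inj₂ a⪰s) (inj₂ a⪰b′) → inj₂ (⪰-set b≡* a⪰s a⪰b′) })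
          (harmless? a b) (harmless? a (set b i ℓ′)) (harmless? a b′) (harmless? a (set b′ i ℓ′)))

    value : ∀ b → (IsCert f ℓ b → ruledOut b ≡ nonℓ) × (¬ IsCert f ℓ b → ruledOut b < nonℓ)
    value b = (λ cert → ∑-cong λ a →
                 ⟦¬⟧-cong [ id , cert (lookup a) ]′ inj₁ (harmless? a b) (f (lookup a) ≟B ℓ))
            , λ ¬cert → let (a₀ , a₀⪰ , fa₀≢ℓ) = counterexample ¬cert in
                ∑-strict (λ a → ⟦¬⟧-antitone inj₁ (harmless? a b) (f (lookup a) ≟B ℓ)) a₀
                  (⟦¬⟧-strict (inj₂ a₀⪰) fa₀≢ℓ (harmless? a₀ b) (f (lookup a₀) ≟B ℓ))

-- Deciding whether a function is a goal function

IsGoal-cong : (∀ b → g b ≡ g′ b) → IsGoal f ℓ g Q → IsGoal f ℓ g′ Q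
IsGoal-cong {g = g} {g′ = g′} {f = f} {ℓ = ℓ} {Q = Q} eq (mono , sub , value) = mono′ , sub′ , value′
  where
  mono′ : MonotoneG g′
  mono′ b i ℓ′ b≡* = subst₂ _≤_ (eq b) (eq (set b i ℓ′)) (mono b i ℓ′ b≡*)
  sub′ : Submodular g′
  sub′ b b′ i ℓ′ ext b≡* b′≡* =
    subst₂ _≤_ (cong₂ _+_ (eq (set b′ i ℓ′)) (eq b)) (cong₂ _+_ (eq (set b i ℓ′)) (eq b′))
      (sub b b′ i ℓ′ ext b≡* b′≡*)
  value′ : ∀ b → (IsCert f ℓ b → g′ b ≡ Q) × (¬ IsCert f ℓ b → g′ b < Q)
  value′ b = (λ cert → trans (sym (eq b)) (proj₁ (value b) cert))
           , (λ ¬cert → subst (_< Q) (eq b) (proj₂ (value b) ¬cert))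

IsGoal⇒≤ : IsGoal f ℓ g Q → Dec (IsCert f ℓ b) → g b ≤ Q
IsGoal⇒≤ {b = b} (_ , _ , value) (yes cert) = ≤-reflexive (proj₁ (value b) cert)
IsGoal⇒≤ {b = b} (_ , _ , value) (no ¬cert) = <⇒≤ (proj₂ (value b) ¬cert)

module _ {f : Assignment n → Bool} (f-cong : f Preserves _≗_ ⟶ _≡_) (ℓ : Bool)
         {g : PAssign n → ℕ} (g-cong : g Preserves _≗_ ⟶ _≡_) (Q : ℕ) where

  MonotoneG? : Dec (MonotoneG g)
  MonotoneG? = ∀-≗-invariant? search-Tri invariant λ v →
    all? λ i → exhaust-Bool λ ℓ′ → (lookup v i ≟T star) →-dec (g (lookup v) ≤? g (set (lookup v) i ℓ′))
    where
    invariant : ∀ {u v} → u ≗ v → (∀ i ℓ′ → u i ≡ star → g u ≤ g (set u i ℓ′)) →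
                ∀ i ℓ′ → v i ≡ star → g v ≤ g (set v i ℓ′)
    invariant eq h i ℓ′ v≡* = subst₂ _≤_ (g-cong eq) (g-cong (set-cong eq)) (h i ℓ′ (trans (eq i) v≡*))

  Submodular? : Dec (Submodular g)
  Submodular? = ∀-≗-invariant? search-Tri invariant λ v → ∀-≗-invariant? search-Tri invariant′ λ v′ →
    all? λ i → exhaust-Bool λ ℓ′ → ⪰ₚ? (lookup v′) (lookup v) →-dec ((lookup v i ≟T star) →-dec
      ((lookup v′ i ≟T star) →-dec
        (g (set (lookup v′) i ℓ′) + g (lookup v) ≤? g (set (lookup v) i ℓ′) + g (lookup v′))))
    where
    SubmodularAt : PAssign n → PAssign n → Set
    SubmodularAt b b′ = ∀ i ℓ′ → b′ ⪰ₚ b → b i ≡ star → b′ i ≡ star →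
      g (set b′ i ℓ′) + g b ≤ g (set b i ℓ′) + g b′
    invariant : ∀ {u v} → u ≗ v → (∀ b′ → SubmodularAt u b′) → ∀ b′ → SubmodularAt v b′
    invariant eq h b′ i ℓ′ ext v≡* b′≡* =
      subst₂ (λ x y → g (set b′ i ℓ′) + x ≤ y + g b′) (g-cong eq) (g-cong (set-cong eq))
        (h b′ i ℓ′ (⪰ₚ-trans ext (≗⇒⪰ₚ eq)) (trans (eq i) v≡*) b′≡*)
    invariant′ : ∀ {b u v} → u ≗ v → SubmodularAt b u → SubmodularAt b v
    invariant′ {b} eq h i ℓ′ ext b≡* v≡* =
      subst₂ (λ x y → x + g b ≤ g (set b i ℓ′) + y) (g-cong (set-cong eq)) (g-cong eq)
        (h i ℓ′ (⪰ₚ-trans (≗⇒⪰ₚ (sym ∘ eq)) ext) b≡* (trans (eq i) v≡*))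

  GoalValued : Set
  GoalValued = ∀ b → (IsCert f ℓ b → g b ≡ Q) × (¬ IsCert f ℓ b → g b < Q)

  GoalValued? : Dec GoalValued
  GoalValued? = ∀-≗-invariant? search-Tri invariant λ v →
    (IsCert? f-cong ℓ (lookup v) →-dec (g (lookup v) ≟ℕ Q))
    ×-dec (¬? (IsCert? f-cong ℓ (lookup v)) →-dec (g (lookup v) <? Q))
    where
    invariant : ∀ {u v} → u ≗ v → (IsCert f ℓ u → g u ≡ Q) × (¬ IsCert f ℓ u → g u < Q) →
                (IsCert f ℓ v → g v ≡ Q) × (¬ IsCert f ℓ v → g v < Q)
    invariant eq (cert⇒ , ¬cert⇒) =
        (λ cert → trans (sym (g-cong eq)) (cert⇒ (IsCert-≗ (sym ∘ eq) cert)))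
      , (λ ¬cert → subst (_< Q) (g-cong eq) (¬cert⇒ (¬cert ∘ IsCert-≗ eq)))

  IsGoal? : Dec (IsGoal f ℓ g Q)
  IsGoal? = MonotoneG? ×-dec Submodular? ×-dec GoalValued?

-- A function Vec Tri m → ℕ bounded by Q, tabulated as a ternary tree of depth m.
Table : ℕ → ℕ → Set
Table Q zero    = Fin (suc Q)
Table Q (suc m) = Table Q m × Table Q m × Table Q m

_!_ : Table Q m → Vec Tri m → ℕ
_!_ {m = zero}  t                 []          = toℕ t
_!_ {m = suc m} (t₀ , t₁ , t★) (zero* ∷ v) = t₀ ! v
_!_ {m = suc m} (t₀ , t₁ , t★) (one*  ∷ v) = t₁ ! v
_!_ {m = suc m} (t₀ , t₁ , t★) (star  ∷ v) = t★ ! v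

search-Table : Searchable (Table Q m)
search-Table {m = zero}  = any?
search-Table {m = suc m} = search-× search-Table (search-× search-Table search-Table)

table : (G : Vec Tri m → ℕ) → (∀ v → G v ≤ Q) → Σ (Table Q m) λ t → ∀ v → t ! v ≡ G v
table {m = zero} G bounded = fromℕ< (s≤s (bounded [])) , λ { [] → toℕ-fromℕ< (s≤s (bounded [])) }
table {m = suc m} G bounded
  with table (G ∘ (zero* ∷_)) (bounded ∘ (zero* ∷_))
     | table (G ∘ (one* ∷_))  (bounded ∘ (one* ∷_))
     | table (G ∘ (star ∷_))  (bounded ∘ (star ∷_))
... | t₀ , eq₀ | t₁ , eq₁ | t★ , eq★ =
  (t₀ , t₁ , t★) , λ { (zero* ∷ v) → eq₀ v ; (one* ∷ v) → eq₁ v ; (star ∷ v) → eq★ v }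

-- Erasure

Free : Bool → PAssign n → Set
Free ℓ b = ∀ i → b i ≢ bit ℓ

eraseSym-star : eraseSym ℓ star ≡ star
eraseSym-star {false} = refl
eraseSym-star {true}  = refl

eraseSym-bit : eraseSym ℓ (bit ℓ) ≡ star
eraseSym-bit {false} = refl
eraseSym-bit {true}  = refl

eraseSym-bit-≢ : ℓ′ ≢ ℓ → eraseSym ℓ (bit ℓ′) ≡ bit ℓ′
eraseSym-bit-≢ {false} {false} ne = contradiction refl ne
eraseSym-bit-≢ {false} {true}  _  = refl
eraseSym-bit-≢ {true}  {false} _  = refl
eraseSym-bit-≢ {true}  {true}  ne = contradiction refl ne

eraseSym-≢bit : eraseSym ℓ t ≢ bit ℓ
eraseSym-≢bit {false} {zero*} ()
eraseSym-≢bit {false} {one*}  ()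
eraseSym-≢bit {false} {star}  ()
eraseSym-≢bit {true}  {zero*} ()
eraseSym-≢bit {true}  {one*}  ()
eraseSym-≢bit {true}  {star}  ()

eraseSym-≢star : eraseSym ℓ t ≢ star → eraseSym ℓ t ≡ t
eraseSym-≢star {false} {zero*} h = contradiction refl h
eraseSym-≢star {false} {one*}  _ = refl
eraseSym-≢star {false} {star}  _ = refl
eraseSym-≢star {true}  {zero*} _ = refl
eraseSym-≢star {true}  {one*}  h = contradiction refl h
eraseSym-≢star {true}  {star}  _ = refl

erase-Free : Free ℓ (erase ℓ b)
erase-Free _ = eraseSym-≢bit

erase-cong : b ≗ b′ → erase ℓ b ≗ erase ℓ b′
erase-cong {ℓ = ℓ} eq i = cong (eraseSym ℓ) (eq i)

erase-idem : erase ℓ (erase ℓ b) ≗ erase ℓ b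
erase-idem {ℓ = ℓ} {b = b} i with eraseSym ℓ (b i) ≟T star
... | yes e≡* = trans (cong (eraseSym ℓ) e≡*) (trans eraseSym-star (sym e≡*))
... | no e≢* = cong (eraseSym ℓ) (eraseSym-≢star e≢*)

erase-star : ∀ (b : PAssign n) {i} → b i ≡ star → erase ℓ b i ≡ star
erase-star {ℓ = ℓ} _ b≡* = trans (cong (eraseSym ℓ) b≡*) eraseSym-star

⪰ₚ-erase : b ⪰ₚ erase ℓ b
⪰ₚ-erase i e≢* = sym (eraseSym-≢star e≢*)

erase-⪰ₚ : b′ ⪰ₚ b → erase ℓ b′ ⪰ₚ erase ℓ b
erase-⪰ₚ {b = b} {ℓ = ℓ} ext i e≢* = cong (eraseSym ℓ) (ext i λ b≡* → e≢* (erase-star b b≡*))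

erase-set-same : b i ≡ star → erase ℓ (set b i ℓ) ≗ erase ℓ b
erase-set-same {b = b} {i = i} {ℓ = ℓ} b≡* j with j ≟ i
... | yes refl = trans (eraseSym-bit {ℓ}) (sym (erase-star b b≡*))
... | no _ = refl

erase-set-≢ : ℓ′ ≢ ℓ → erase ℓ (set b i ℓ′) ≗ set (erase ℓ b) i ℓ′
erase-set-≢ {i = i} ne j with j ≟ i
... | yes _ = eraseSym-bit-≢ ne
... | no _ = refl

set-Free : ℓ′ ≢ ℓ → Free ℓ b → Free ℓ (set b i ℓ′)
set-Free {i = i} ne free j with j ≟ i
... | yes _ = ne ∘ bit-injective
... | no _ = free j

fill-toward : (eraseSym (not ℓ) t ≢ star → bit x ≡ eraseSym (not ℓ) t) → fill t x ≤[ ℓ ] x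
fill-toward {true}  {zero*} _ = f≤b
fill-toward {true}  {one*}  h rewrite bit-injective {y = true} (h λ ()) = t≤t
fill-toward {true}  {star}  _ = ≤ᵇ-refl
fill-toward {false} {zero*} h rewrite bit-injective {y = false} (h λ ()) = f≤b
fill-toward {false} {one*}  _ = ≤ᵇ-true
fill-toward {false} {star}  _ = ≤ᵇ-refl

-- The completion of b by a agrees with b, so has value ℓ; and a arises from it by moving
-- coordinates towards ℓ, since a agrees with b wherever b is ℓ.
IsCert-erase : Monotone f → IsCert f ℓ b → IsCert f ℓ (erase (not ℓ) b)
IsCert-erase {b = b} mf cert a a⪰ =
  monotone-toward mf (λ j → fill-toward {t = b j} (a⪰ j)) (cert (complete b a) complete-⪰)

IsCert-unerase : IsCert f ℓ (erase ℓ′ b) → IsCert f ℓ b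
IsCert-unerase = IsCert-⪰ₚ ⪰ₚ-erase

erase-goal : Monotone f → IsGoal f ℓ g Q →
             (∀ {b b′} → Free (not ℓ) b → b ≗ b′ → g b ≡ g b′) →
             IsGoal f ℓ (g ∘ erase (not ℓ)) Q
erase-goal {f = f} {ℓ = ℓ} {g = g} {Q = Q} mf (mono , sub , value) g-cong = mono′ , sub′ , value′
  where
  ℓ̄ : Bool
  ℓ̄ = not ℓ

  fix-¬ℓ : ∀ {b : PAssign _} {i} → b i ≡ star → g (erase ℓ̄ (set b i ℓ̄)) ≡ g (erase ℓ̄ b)
  fix-¬ℓ b≡* = g-cong erase-Free (erase-set-same b≡*)

  fix-ℓ : ∀ {b : PAssign _} {i ℓ′} → ℓ′ ≢ ℓ̄ → g (set (erase ℓ̄ b) i ℓ′) ≡ g (erase ℓ̄ (set b i ℓ′))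
  fix-ℓ ne = g-cong (set-Free ne erase-Free) (sym ∘ erase-set-≢ ne)

  mono′ : MonotoneG (g ∘ erase ℓ̄)
  mono′ b i ℓ′ b≡* with ℓ′ ≟B ℓ̄
  ... | yes refl = ≤-reflexive (sym (fix-¬ℓ b≡*))
  ... | no ne = ≤-trans (mono (erase ℓ̄ b) i ℓ′ (erase-star b b≡*)) (≤-reflexive (fix-ℓ ne))

  sub′ : Submodular (g ∘ erase ℓ̄)
  sub′ b b′ i ℓ′ ext b≡* b′≡* with ℓ′ ≟B ℓ̄
  ... | yes refl = ≤-reflexive (begin
    g (erase ℓ̄ (set b′ i ℓ̄)) + g (erase ℓ̄ b)  ≡⟨ cong (_+ g (erase ℓ̄ b)) (fix-¬ℓ b′≡*) ⟩
    g (erase ℓ̄ b′) + g (erase ℓ̄ b)            ≡⟨ +-comm (g (erase ℓ̄ b′)) _ ⟩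
    g (erase ℓ̄ b) + g (erase ℓ̄ b′)            ≡⟨ cong (_+ g (erase ℓ̄ b′)) (sym (fix-¬ℓ b≡*)) ⟩
    g (erase ℓ̄ (set b i ℓ̄)) + g (erase ℓ̄ b′)  ∎)
    where open ≡-Reasoning
  ... | no ne = subst₂ (λ x y → x + g (erase ℓ̄ b) ≤ y + g (erase ℓ̄ b′)) (fix-ℓ ne) (fix-ℓ ne)
    (sub (erase ℓ̄ b) (erase ℓ̄ b′) i ℓ′ (erase-⪰ₚ ext) (erase-star b b≡*) (erase-star b′ b′≡*))

  value′ : ∀ b → (IsCert f ℓ b → g (erase ℓ̄ b) ≡ Q) × (¬ IsCert f ℓ b → g (erase ℓ̄ b) < Q)
  value′ b = (λ cert → proj₁ (value (erase ℓ̄ b)) (IsCert-erase mf cert))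
           , (λ ¬cert → proj₂ (value (erase ℓ̄ b)) (¬cert ∘ IsCert-unerase))

submodular-sandwich : Submodular g → b ≗ b′ → b i ≡ star →
                      g (set b i ℓ) ≡ g (set b′ i ℓ) → g b ≡ g b′
submodular-sandwich {g = g} {b = b} {b′ = b′} {i = i} {ℓ = ℓ} sub eq b≡* set-eq =
  ≤-antisym (+-cancelˡ-≤ (g (set b i ℓ)) _ _ b≤b′) (+-cancelˡ-≤ (g (set b i ℓ)) _ _ b′≤b)
  where
  b′≡* : b′ i ≡ star
  b′≡* = trans (sym (eq i)) b≡*
  b≤b′ : g (set b i ℓ) + g b ≤ g (set b i ℓ) + g b′
  b≤b′ = subst (λ x → x + g b ≤ g (set b i ℓ) + g b′) (sym set-eq)
                (sub b b′ i ℓ (≗⇒⪰ₚ eq) b≡* b′≡*)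
  b′≤b : g (set b i ℓ) + g b′ ≤ g (set b i ℓ) + g b
  b′≤b = subst (λ x → g (set b i ℓ) + g b′ ≤ x + g b) (sym set-eq)
                (sub b′ b i ℓ (≗⇒⪰ₚ (sym ∘ eq)) b′≡* b≡*)

StarsIn : List (Fin n) → PAssign n → Set
StarsIn L b = ∀ i → b i ≡ star → i ∈ L

StarsIn-set : StarsIn L b → StarsIn L (set b i ℓ)
StarsIn-set {i = i} stars j s≡* with j ≟ i
... | yes refl = contradiction s≡* bit≢star
... | no _ = stars j s≡*

StarsIn-∷ : StarsIn (j ∷ L) b → b j ≢ star → StarsIn L b
StarsIn-∷ stars bj≢* i b≡* with stars i b≡*
... | here refl = contradiction b≡* bj≢*
... | there i∈L = i∈L

-- When f (ℓ, …, ℓ) = ℓ, an ℓ-goal function respects pointwise equality on ¬ℓ-free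
-- assignments: the total ones among them are certificates, and submodularity
-- propagates agreement from b_{x_i←ℓ} to b, one star at a time.
module _ {f : Assignment n → Bool} (mf : Monotone f) {ℓ : Bool} (all-ℓ : f (λ _ → ℓ) ≡ ℓ)
         {g : PAssign n → ℕ} {Q : ℕ} (goal : IsGoal f ℓ g Q) where

  private
    sub : Submodular g
    sub = proj₁ (proj₂ goal)
    value : ∀ b → (IsCert f ℓ b → g b ≡ Q) × (¬ IsCert f ℓ b → g b < Q)
    value = proj₂ (proj₂ goal)

  total-cert : (∀ i → b i ≢ star) → Free (not ℓ) b → IsCert f ℓ b
  total-cert full free a a⪰ = monotone-toward mf (λ i → subst (ℓ ≤[ ℓ ]_) (sym (a≡ℓ i)) ≤[]-refl) all-ℓ
    where
    a≡ℓ : ∀ i → a i ≡ ℓ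
    a≡ℓ i = bit-injective (trans (a⪰ i (full i)) (tri≡bit (full i) (free i)))

  congruent-within : ∀ L {b b′} → StarsIn L b → Free (not ℓ) b → b ≗ b′ → g b ≡ g b′
  congruent-within [] {b} {b′} stars free eq =
    trans (proj₁ (value b) cert) (sym (proj₁ (value b′) (IsCert-≗ eq cert)))
    where
    cert : IsCert f ℓ b
    cert = total-cert (λ i b≡* → case stars i b≡* of λ ()) free
  congruent-within (p ∷ L) {b} stars free eq with b p ≟T star
  ... | yes bp≡* = submodular-sandwich sub eq bp≡*
      (congruent-within L (StarsIn-∷ (StarsIn-set stars) (bit≢star ∘ trans (sym (set-≡ b p ℓ))))
                        (set-Free (not-¬ refl) free) (set-cong eq))
  ... | no bp≢* = congruent-within L (StarsIn-∷ stars bp≢*) free eq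

  congruent-on-Free : ∀ {b b′} → Free (not ℓ) b → b ≗ b′ → g b ≡ g b′
  congruent-on-Free = congruent-within (allFin n) (λ i _ → ∈-allFin i)

const-goal : (∀ b → ¬ IsCert f ℓ b) → 0 < Q → IsGoal f ℓ (const 0) Q
const-goal no-cert 0<Q =
  (λ _ _ _ _ → z≤n) , (λ _ _ _ _ _ _ _ → ≤-refl)
  , λ b → (λ cert → contradiction cert (no-cert b)) , const 0<Q

congruent-goal : Monotone f → IsGoal f ℓ g Q →
                 Σ (PAssign n → ℕ) λ g′ → IsGoal f ℓ g′ Q × g′ Preserves _≗_ ⟶ _≡_
congruent-goal {f = f} {ℓ = ℓ} {g = g} {Q = Q} mf goal with f (λ _ → ℓ) ≟B ℓ
... | yes all-ℓ = g ∘ erase (not ℓ) , erase-goal mf goal (congruent-on-Free mf all-ℓ goal)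
                , congruent-on-Free mf all-ℓ goal erase-Free ∘ erase-cong
... | no ¬all-ℓ = const 0 , const-goal no-cert 0<Q , λ _ → refl
  where
  no-cert : ∀ b → ¬ IsCert f ℓ b
  no-cert _ = ¬all-ℓ ∘ all-ℓ-if-cert mf
  0<Q : 0 < Q
  0<Q = ≤-<-trans z≤n (proj₂ (proj₂ (proj₂ goal) (λ _ → star)) (no-cert _))

module _ {f : Assignment n → Bool} (mf : Monotone f) (ℓ : Bool) where

  Tabled : ℕ → Set
  Tabled Q = Σ (Table Q n) λ t → IsGoal f ℓ (λ b → t ! tabulate b) Q

  Tabled? : ∀ Q → Dec (Tabled Q)
  Tabled? Q = search-Table λ t → IsGoal? (monotone-cong mf) ℓ (cong (t !_) ∘ tabulate-cong) Q

  tabled : IsGoal f ℓ g Q → Tabled Q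
  tabled goal with congruent-goal mf goal
  ... | g′ , goal′ , g′-cong
      with table (g′ ∘ lookup) (λ v → IsGoal⇒≤ goal′ (IsCert? (monotone-cong mf) ℓ (lookup v)))
  ... | t , t≡g′ =
    t , IsGoal-cong (λ b → sym (trans (t≡g′ (tabulate b)) (g′-cong (lookup∘tabulate b)))) goal′

  optimal-goal : Σ (PAssign n → ℕ) λ g → Σ ℕ λ Q →
                 IsGoal f ℓ g Q × NoValueTo (not ℓ) g × IsGamma f ℓ Q
  optimal-goal with least Tabled? (tabled (ruledOut-goal (monotone-cong mf) ℓ))
  ... | Q , (t , goal) , minimal = g₀ , Q , goal′ , no-value , (g₀ , goal′) , λ _ _ → minimal ∘ tabled
    where
    h : PAssign n → ℕ
    h b = t ! tabulate b
    h-cong : h Preserves _≗_ ⟶ _≡_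
    h-cong = cong (t !_) ∘ tabulate-cong
    g₀ : PAssign n → ℕ
    g₀ = h ∘ erase (not ℓ)
    goal′ : IsGoal f ℓ g₀ Q
    goal′ = erase-goal mf goal (λ _ → h-cong)
    no-value : NoValueTo (not ℓ) g₀
    no-value b = h-cong (sym ∘ erase-idem {ℓ = not ℓ} {b = b})

lemma4 : ∀ (n : ℕ) (f : Assignment n → Bool) → Monotone f →
    (Σ (PAssign n → ℕ) λ g → Σ ℕ λ Q →
       IsGoal f true g Q × NoValueTo false g × IsGamma f true Q)
    × (Σ (PAssign n → ℕ) λ g → Σ ℕ λ Q →
       IsGoal f false g Q × NoValueTo true g × IsGamma f false Q)
lemma4 n f mf = optimal-goal mf true , optimal-goal mf false
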